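{- If $D\in\mathcal{D}$ and $H$ is a graph on at least one vertex, then $D\sqcup H\in\mathcal{C}$. Furthermore, $D\sqcup H$ is not complementary vanishing.
   Context: For a graph $G$ with vertex set $\{v_1,\dots,v_n\}$, $\mathcal{S}(G)$ is the set of real symmetric $n\times n$ matrices $A=[a_{i,j}]$ such that for $i\neq j$, $a_{i,j}\neq 0$ if and only if $v_iv_j\in E(G)$ (diagonal entries are unrestricted). $\overline{G}$ is the complement of $G$. $G$ is complementary vanishing if there exist $A\in\mathcal{S}(G)$, $B\in\mathcal{S}(\overline{G})$ with $AB=O$. $\mathcal{M}$ is the set of complementary vanishing graphs $G$ with $G$ and $\overline{G}$ both connected; $\mathcal{R}$ is the smallest set of graphs containing $\mathcal{M}$ closed under disjoint unions, joins and complements. $\mathcal{D}\subseteq\mathcal{R}$ is the set of graphs in $\mathcal{R}$ that contain a leaf (vertex of degree 1) adjacent to a vertex of degree at least $2$. $\mathcal{C}$ is the set of graphs $G$ such that in $G$ or in $\overline{G}$ (neighborhoods taken in that graph) there exist distinct vertices $u,v,w$ with $v,w\notin N(u)$, $|N(u)\setminus N(w)|=1$ and $|N(u)\setminus N(v)|=0$, $N(x)$ being the open neighborhood. $D\sqcup H$ is the disjoint union. -}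

module Defs where

open import Level using (0ℓ)
open import Data.Nat using (ℕ; zero; suc; _≤_) renaming (_+_ to _+ℕ_)
open import Data.Bool using (Bool; true; false; not; _∧_; if_then_else_)
open import Data.Fin using (Fin; splitAt; _≟_)
import Data.Fin as F
open import Data.Sum using (_⊎_; inj₁; inj₂)
open import Data.Product using (Σ; ∃; _×_; _,_; Σ-syntax; ∃-syntax)
open import Data.Empty using (⊥; ⊥-elim)
open import Relation.Nullary using (¬_; yes; no)
open import Relation.Binary.PropositionalEquality using (_≡_; _≢_; refl; cong)
import Relation.Binary.PropositionalEquality as Eq
open import Function.Bundles using (Inverse)

-- The real numbers, axiomatised as a (Dedekind-)complete ordered field.
-- Any two such structures are isomorphic, so quantifying over all of
-- them is the same as speaking about ℝ.

record RealField : Set₁ where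
  infixl 6 _+_
  infixl 7 _*_
  infix 4 _<_ _≤ᵣ_
  field
    Carrier : Set
    0# 1#   : Carrier
    _+_ _*_ : Carrier → Carrier → Carrier
    -_      : Carrier → Carrier
    _⁻¹     : Carrier → Carrier
    _<_     : Carrier → Carrier → Set
    +-assoc   : ∀ x y z → (x + y) + z ≡ x + (y + z)
    +-comm    : ∀ x y → x + y ≡ y + x
    +-identityˡ : ∀ x → 0# + x ≡ x
    -‿inverseˡ : ∀ x → (- x) + x ≡ 0#
    *-assoc   : ∀ x y z → (x * y) * z ≡ x * (y * z)
    *-comm    : ∀ x y → x * y ≡ y * x
    *-identityˡ : ∀ x → 1# * x ≡ x
    ⁻¹-inverseˡ : ∀ x → x ≢ 0# → (x ⁻¹) * x ≡ 1#
    distribˡ  : ∀ x y z → x * (y + z) ≡ (x * y) + (x * z)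
    0≢1       : 0# ≢ 1#
    <-irrefl  : ∀ x → ¬ (x < x)
    <-trans   : ∀ {x y z} → x < y → y < z → x < z
    <-trichotomy : ∀ x y → (x < y) ⊎ (x ≡ y) ⊎ (y < x)
    +-mono-<  : ∀ {x y} z → x < y → x + z < y + z
    *-pos     : ∀ {x y} → 0# < x → 0# < y → 0# < x * y
  _≤ᵣ_ : Carrier → Carrier → Set
  x ≤ᵣ y = (x < y) ⊎ (x ≡ y)
  field
    sup : ∀ (P : Carrier → Set) → (∃ λ x → P x) →
          (∃ λ b → ∀ x → P x → x ≤ᵣ b) →
          ∃ λ s → (∀ x → P x → x ≤ᵣ s) × (∀ b → (∀ x → P x → x ≤ᵣ b) → s ≤ᵣ b)

record Graph (n : ℕ) : Set where
  field
    adj    : Fin n → Fin n → Bool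
    sym    : ∀ i j → adj i j ≡ adj j i
    irrefl : ∀ i → adj i i ≡ false
open Graph public

complAdj : ∀ {n} → Graph n → Fin n → Fin n → Bool
complAdj G i j with i ≟ j
... | yes _ = false
... | no _  = not (adj G i j)

complSym : ∀ {n} (G : Graph n) i j → complAdj G i j ≡ complAdj G j i
complSym G i j with i ≟ j | j ≟ i
... | yes _ | yes _ = refl
... | yes p | no q  = ⊥-elim (q (Eq.sym p))
... | no p  | yes q = ⊥-elim (p (Eq.sym q))
... | no _  | no _  = cong not (sym G i j)

complIrrefl : ∀ {n} (G : Graph n) i → complAdj G i i ≡ false
complIrrefl G i with i ≟ i
... | yes _ = refl
... | no p  = ⊥-elim (p refl)

compl : ∀ {n} → Graph n → Graph n
compl G = record { adj = complAdj G ; sym = complSym G ; irrefl = complIrrefl G }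

-- disjoint union (c = false) and join (c = true) of two graphs;
-- vertices of G come first, then those of H.
sumAdj : ∀ {m n} → Bool → Graph m → Graph n →
         Fin m ⊎ Fin n → Fin m ⊎ Fin n → Bool
sumAdj c G H (inj₁ a) (inj₁ b) = adj G a b
sumAdj c G H (inj₂ a) (inj₂ b) = adj H a b
sumAdj c G H (inj₁ _) (inj₂ _) = c
sumAdj c G H (inj₂ _) (inj₁ _) = c

sumAdjSym : ∀ {m n} c (G : Graph m) (H : Graph n) x y →
            sumAdj c G H x y ≡ sumAdj c G H y x
sumAdjSym c G H (inj₁ a) (inj₁ b) = sym G a b
sumAdjSym c G H (inj₂ a) (inj₂ b) = sym H a b
sumAdjSym c G H (inj₁ _) (inj₂ _) = refl
sumAdjSym c G H (inj₂ _) (inj₁ _) = refl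

sumAdjIrrefl : ∀ {m n} c (G : Graph m) (H : Graph n) x →
               sumAdj c G H x x ≡ false
sumAdjIrrefl c G H (inj₁ a) = irrefl G a
sumAdjIrrefl c G H (inj₂ a) = irrefl H a

sumGraph : ∀ {m n} → Bool → Graph m → Graph n → Graph (m +ℕ n)
sumGraph {m} c G H = record
  { adj    = λ i j → sumAdj c G H (splitAt m i) (splitAt m j)
  ; sym    = λ i j → sumAdjSym c G H (splitAt m i) (splitAt m j)
  ; irrefl = λ i → sumAdjIrrefl c G H (splitAt m i) }

infixr 5 _⊔_ _∨ᵍ_
_⊔_ : ∀ {m n} → Graph m → Graph n → Graph (m +ℕ n)
G ⊔ H = sumGraph false G H

_∨ᵍ_ : ∀ {m n} → Graph m → Graph n → Graph (m +ℕ n)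
G ∨ᵍ H = sumGraph true G H

record _≅_ {m n} (G : Graph m) (H : Graph n) : Set where
  field
    bij  : Inverse (Eq.setoid (Fin m)) (Eq.setoid (Fin n))
    pres : ∀ i j → adj H (Inverse.to bij i) (Inverse.to bij j) ≡ adj G i j

data Walk {n} (G : Graph n) : Fin n → Fin n → Set where
  here : ∀ {i} → Walk G i i
  step : ∀ {i k j} → adj G i k ≡ true → Walk G k j → Walk G i j

Connected : ∀ {n} → Graph n → Set
Connected G = ∀ i j → Walk G i j

countF : ∀ {n} → (Fin n → Bool) → ℕ
countF {zero}  f = 0
countF {suc n} f = (if f F.zero then 1 else 0) +ℕ countF (λ i → f (F.suc i))

deg : ∀ {n} → Graph n → Fin n → ℕ
deg G v = countF (adj G v)

module _ (ℝ : RealField) where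
  open RealField ℝ

  sumR : ∀ {n} → (Fin n → Carrier) → Carrier
  sumR {zero}  f = 0#
  sumR {suc n} f = f F.zero + sumR (λ i → f (F.suc i))

  Matrix : ℕ → Set
  Matrix n = Fin n → Fin n → Carrier

  InS : ∀ {n} → Graph n → Matrix n → Set
  InS G A = (∀ i j → A i j ≡ A j i) ×
            (∀ i j → i ≢ j → (A i j ≢ 0# → adj G i j ≡ true) ×
                              (adj G i j ≡ true → A i j ≢ 0#))

  CompVanishing : ∀ {n} → Graph n → Set
  CompVanishing {n} G =
    Σ[ A ∈ Matrix n ] Σ[ B ∈ Matrix n ]
      InS G A × InS (compl G) B ×
      (∀ i k → sumR (λ j → A i j * B j k) ≡ 0#)

  InM : ∀ {n} → Graph n → Set
  InM G = CompVanishing G × Connected G × Connected (compl G)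

  -- the set 𝓡: smallest class of (unlabelled, i.e. isomorphism-closed)
  -- graphs containing 𝓜, closed under disjoint union, join and complement
  data InR : ∀ {n} → Graph n → Set where
    fromM  : ∀ {n} {G : Graph n} → InM G → InR G
    union  : ∀ {m n} {G : Graph m} {H : Graph n} → InR G → InR H → InR (G ⊔ H)
    join   : ∀ {m n} {G : Graph m} {H : Graph n} → InR G → InR H → InR (G ∨ᵍ H)
    compR  : ∀ {n} {G : Graph n} → InR G → InR (compl G)
    isoR   : ∀ {m n} {G : Graph m} {H : Graph n} → InR G → G ≅ H → InR H

  InD : ∀ {n} → Graph n → Set
  InD {n} G = InR G ×
    (Σ[ ℓ ∈ Fin n ] Σ[ x ∈ Fin n ]
       deg G ℓ ≡ 1 × adj G ℓ x ≡ true × 2 ≤ deg G x)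

CCond : ∀ {n} → Graph n → Set
CCond {n} G =
  Σ[ u ∈ Fin n ] Σ[ v ∈ Fin n ] Σ[ w ∈ Fin n ]
    u ≢ v × u ≢ w × v ≢ w ×
    adj G u v ≡ false × adj G u w ≡ false ×
    countF (λ x → adj G u x ∧ not (adj G w x)) ≡ 1 ×
    countF (λ x → adj G u x ∧ not (adj G v x)) ≡ 0

InC : ∀ {n} → Graph n → Set
InC G = CCond G ⊎ CCond (compl G)

-- A leaf ℓ of D has a single neighbour x, and x has a further neighbour y;
-- any vertex w of H is adjacent to neither.  Then N(ℓ) ⊆ N(y) and
-- N(ℓ) ∖ N(w) = {x}, which is the 𝒞-configuration (u, v, w) = (ℓ, y, w).
-- Such a configuration obstructs complementary vanishing: if A ∈ 𝒮(G),
-- B ∈ 𝒮(Ḡ) and AB = O, then row u of A is supported on {u} ∪ N(u).  Entry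
-- (u, v) of AB reduces to A_uu B_uv with B_uv ≠ 0, forcing A_uu = 0; entry
-- (u, w) then reduces to A_ux B_xw, a product of two nonzero reals.
module Submission where

open import Defs hiding (sym)
open import Data.Nat using (ℕ; zero; suc; _≤_)
import Data.Nat as ℕ
import Data.Nat.Properties as ℕₚ
open import Data.Bool using (Bool; true; false; not; _∧_; if_then_else_)
open import Data.Fin using (Fin; _↑ˡ_; _↑ʳ_; _≟_)
import Data.Fin as F
open import Data.Fin.Properties using (splitAt-↑ˡ; splitAt-↑ʳ; ↑ˡ-injective)
import Data.Fin.Properties as FinP
open import Data.Product using (_×_; _,_; ∃; proj₁; proj₂)
open import Data.Sum using (_⊎_; inj₁; inj₂)
open import Function using (_∘_)
open import Relation.Nullary using (¬_; yes; no; contradiction)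
open import Relation.Binary.PropositionalEquality
  using (_≡_; _≢_; refl; sym; trans; cong; cong₂; subst; module ≡-Reasoning)

private
  variable
    n : ℕ

true≢false : true ≢ false
true≢false ()

∧-not-true : ∀ {a b} → a ∧ not b ≡ true → a ≡ true × b ≡ false
∧-not-true {true} {false} refl = refl , refl

∧-not-false : ∀ {a b} → a ≡ true → a ∧ not b ≡ false → b ≡ true
∧-not-false {b = true} refl refl = refl

countF-cong : {f g : Fin n → Bool} → (∀ i → f i ≡ g i) → countF f ≡ countF g
countF-cong {zero}  f≗g = refl
countF-cong {suc n} f≗g =
  cong₂ ℕ._+_ (cong (λ b → if b then 1 else 0) (f≗g F.zero))
              (countF-cong (f≗g ∘ F.suc))

countF-↑ : ∀ m {n} (f : Fin (m ℕ.+ n) → Bool) →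
           countF f ≡ countF (λ i → f (i ↑ˡ n)) ℕ.+ countF (λ j → f (m ↑ʳ j))
countF-↑ zero    f = refl
countF-↑ (suc m) f =
  trans (cong (head ℕ.+_) (countF-↑ m (f ∘ F.suc))) (sym (ℕₚ.+-assoc head _ _))
  where
  head : ℕ
  head = if f F.zero then 1 else 0

countF≡0⇒false : (f : Fin n → Bool) → countF f ≡ 0 → ∀ i → f i ≡ false
countF≡0⇒false {suc n} f e i with f F.zero in f0
countF≡0⇒false {suc n} f () i         | true
countF≡0⇒false {suc n} f e F.zero     | false = f0
countF≡0⇒false {suc n} f e (F.suc i)  | false = countF≡0⇒false (f ∘ F.suc) e i

false⇒countF≡0 : (f : Fin n → Bool) → (∀ i → f i ≡ false) → countF f ≡ 0
false⇒countF≡0 {zero}  f f≡false = refl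
false⇒countF≡0 {suc n} f f≡false rewrite f≡false F.zero =
  false⇒countF≡0 (f ∘ F.suc) (f≡false ∘ F.suc)

countF≥1⇒∃ : (f : Fin n → Bool) → 1 ≤ countF f → ∃ λ i → f i ≡ true
countF≥1⇒∃ {suc n} f c with f F.zero in f0
... | true  = F.zero , f0
... | false with countF≥1⇒∃ (f ∘ F.suc) c
...   | i , fi = F.suc i , fi

countF≥2⇒other : (f : Fin n → Bool) → 2 ≤ countF f →
                 ∀ i → ∃ λ j → j ≢ i × f j ≡ true
countF≥2⇒other {suc n} f c i with f F.zero in f0
countF≥2⇒other {suc n} f (ℕ.s≤s c) F.zero | true with countF≥1⇒∃ (f ∘ F.suc) c
... | j , fj = F.suc j , (λ ()) , fj
countF≥2⇒other {suc n} f c (F.suc i) | true = F.zero , (λ ()) , f0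
countF≥2⇒other {suc n} f c F.zero | false with countF≥1⇒∃ (f ∘ F.suc) (ℕₚ.≤-trans (ℕₚ.n≤1+n 1) c)
... | j , fj = F.suc j , (λ ()) , fj
countF≥2⇒other {suc n} f c (F.suc i) | false with countF≥2⇒other (f ∘ F.suc) c i
... | j , j≢i , fj = F.suc j , j≢i ∘ FinP.suc-injective , fj

countF≡1⇒∃! : (f : Fin n → Bool) → countF f ≡ 1 →
              ∃ λ i → f i ≡ true × (∀ j → f j ≡ true → j ≡ i)
countF≡1⇒∃! {suc n} f c with f F.zero in f0
... | true = F.zero , f0 , only-zero
  where
  only-zero : ∀ j → f j ≡ true → j ≡ F.zero
  only-zero F.zero    _  = refl
  only-zero (F.suc j) fj =
    contradiction (trans (sym fj) (countF≡0⇒false (f ∘ F.suc) (ℕₚ.suc-injective c) j)) true≢false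
... | false with countF≡1⇒∃! (f ∘ F.suc) c
...   | i , fi , unique = F.suc i , fi , unique′
  where
  unique′ : ∀ j → f j ≡ true → j ≡ F.suc i
  unique′ F.zero    fj = contradiction (trans (sym fj) f0) true≢false
  unique′ (F.suc j) fj = cong F.suc (unique j fj)

countF≡1⇒unique : (f : Fin n → Bool) → countF f ≡ 1 →
                  ∀ {i j} → f i ≡ true → f j ≡ true → j ≡ i
countF≡1⇒unique f c fi fj with countF≡1⇒∃! f c
... | _ , _ , unique = trans (unique _ fj) (sym (unique _ fi))

unique⇒countF≡1 : (f : Fin n → Bool) {i : Fin n} → f i ≡ true →
                  (∀ j → f j ≡ true → j ≡ i) → countF f ≡ 1
unique⇒countF≡1 {suc n} f {F.zero} fi unique rewrite fi =
  cong suc (false⇒countF≡0 (f ∘ F.suc) tail-false)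
  where
  tail-false : ∀ j → f (F.suc j) ≡ false
  tail-false j with f (F.suc j) in fj
  ... | false = refl
  ... | true  with unique (F.suc j) fj
  ...   | ()
unique⇒countF≡1 {suc n} f {F.suc i} fi unique with f F.zero in f0
... | true  with unique F.zero f0
...   | ()
unique⇒countF≡1 {suc n} f {F.suc i} fi unique | false =
  unique⇒countF≡1 (f ∘ F.suc) fi (λ j fj → FinP.suc-injective (unique (F.suc j) fj))

module _ (G : Graph n) where

  adj⇒≢ : ∀ {i j} → adj G i j ≡ true → i ≢ j
  adj⇒≢ {i} ij refl = true≢false (trans (sym ij) (irrefl G i))

  adj-separates : ∀ {i j k} → adj G i j ≡ true → adj G i k ≡ false → j ≢ k
  adj-separates ij ik refl = true≢false (trans (sym ij) ik)

  compl-adj : ∀ {i j} → i ≢ j → adj (compl G) i j ≡ not (adj G i j)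
  compl-adj {i} {j} i≢j with i ≟ j
  ... | yes i≡j = contradiction i≡j i≢j
  ... | no  _   = refl

  leaf-neighbour : ∀ {ℓ x j} → deg G ℓ ≡ 1 → adj G ℓ x ≡ true →
                   adj G ℓ j ≡ true → j ≡ x
  leaf-neighbour {ℓ} d ℓx ℓj = countF≡1⇒unique (adj G ℓ) d ℓx ℓj

  pendant⇒CCond : ∀ {ℓ x y w} → deg G ℓ ≡ 1 → adj G ℓ x ≡ true →
                  adj G x y ≡ true → y ≢ ℓ →
                  adj G ℓ w ≡ false → adj G x w ≡ false → CCond G
  pendant⇒CCond {ℓ} {x} {y} {w} d ℓx xy y≢ℓ ℓw xw =
    ℓ , y , w , y≢ℓ ∘ sym , adj-separates xℓ xw , adj-separates xy xw ,
    ℓy , ℓw ,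
    unique⇒countF≡1 _ (cong₂ (λ a b → a ∧ not b) ℓx (trans (Graph.sym G w x) xw)) only-x ,
    false⇒countF≡0 _ N[ℓ]⊆N[y]
    where
    xℓ : adj G x ℓ ≡ true
    xℓ = trans (Graph.sym G x ℓ) ℓx

    ℓy : adj G ℓ y ≡ false
    ℓy with adj G ℓ y in e
    ... | false = refl
    ... | true  = contradiction (sym (leaf-neighbour d ℓx e)) (adj⇒≢ xy)

    only-x : ∀ j → adj G ℓ j ∧ not (adj G w j) ≡ true → j ≡ x
    only-x j e with ∧-not-true e
    ... | ℓj , _ = leaf-neighbour d ℓx ℓj

    N[ℓ]⊆N[y] : ∀ j → adj G ℓ j ∧ not (adj G y j) ≡ false
    N[ℓ]⊆N[y] j with adj G ℓ j in e
    ... | false = refl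
    ... | true rewrite leaf-neighbour d ℓx e | Graph.sym G y x | xy = refl

module _ {m n} (D : Graph m) (H : Graph n) where

  ⊔-adj-↑ˡ : ∀ i j → adj (D ⊔ H) (i ↑ˡ n) (j ↑ˡ n) ≡ adj D i j
  ⊔-adj-↑ˡ i j rewrite splitAt-↑ˡ m i n | splitAt-↑ˡ m j n = refl

  ⊔-adj-↑ˡ↑ʳ : ∀ i j → adj (D ⊔ H) (i ↑ˡ n) (m ↑ʳ j) ≡ false
  ⊔-adj-↑ˡ↑ʳ i j rewrite splitAt-↑ˡ m i n | splitAt-↑ʳ m n j = refl

  deg-⊔-↑ˡ : ∀ i → deg (D ⊔ H) (i ↑ˡ n) ≡ deg D i
  deg-⊔-↑ˡ i = begin
    deg (D ⊔ H) (i ↑ˡ n)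
      ≡⟨ countF-↑ m (adj (D ⊔ H) (i ↑ˡ n)) ⟩
    countF (λ j → adj (D ⊔ H) (i ↑ˡ n) (j ↑ˡ n)) ℕ.+ countF (λ j → adj (D ⊔ H) (i ↑ˡ n) (m ↑ʳ j))
      ≡⟨ cong₂ ℕ._+_ (countF-cong (⊔-adj-↑ˡ i)) (false⇒countF≡0 _ (⊔-adj-↑ˡ↑ʳ i)) ⟩
    deg D i ℕ.+ 0
      ≡⟨ ℕₚ.+-identityʳ (deg D i) ⟩
    deg D i ∎
    where open ≡-Reasoning

module _ (ℝ : RealField) where
  open RealField ℝ

  ≡0-stable : ∀ {x} → ¬ (x ≢ 0#) → x ≡ 0#
  ≡0-stable {x} ¬x≢0 with <-trichotomy x 0#
  ... | inj₁ x<0        = contradiction (λ x≡0 → <-irrefl 0# (subst (_< 0#) x≡0 x<0)) ¬x≢0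
  ... | inj₂ (inj₁ x≡0) = x≡0
  ... | inj₂ (inj₂ 0<x) = contradiction (λ x≡0 → <-irrefl 0# (subst (0# <_) x≡0 0<x)) ¬x≢0

  +-identityʳ : ∀ x → x + 0# ≡ x
  +-identityʳ x = trans (+-comm x 0#) (+-identityˡ x)

  *-zeroʳ : ∀ x → x * 0# ≡ 0#
  *-zeroʳ x = begin
    x * 0#                         ≡⟨ sym (+-identityˡ _) ⟩
    0# + x * 0#                    ≡⟨ cong (_+ x * 0#) (sym (-‿inverseˡ _)) ⟩
    (- (x * 0#) + x * 0#) + x * 0# ≡⟨ +-assoc _ _ _ ⟩
    - (x * 0#) + (x * 0# + x * 0#) ≡⟨ cong (- (x * 0#) +_) (sym (distribˡ x 0# 0#)) ⟩
    - (x * 0#) + x * (0# + 0#)     ≡⟨ cong (λ z → - (x * 0#) + x * z) (+-identityˡ 0#) ⟩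
    - (x * 0#) + x * 0#            ≡⟨ -‿inverseˡ _ ⟩
    0#                             ∎
    where open ≡-Reasoning

  *-zeroˡ : ∀ x → 0# * x ≡ 0#
  *-zeroˡ x = trans (*-comm 0# x) (*-zeroʳ x)

  *-integral : ∀ {x y} → x ≢ 0# → x * y ≡ 0# → y ≡ 0#
  *-integral {x} {y} x≢0 xy≡0 = begin
    y                  ≡⟨ sym (*-identityˡ y) ⟩
    1# * y             ≡⟨ cong (_* y) (sym (⁻¹-inverseˡ x x≢0)) ⟩
    (x ⁻¹ * x) * y     ≡⟨ *-assoc _ _ _ ⟩
    x ⁻¹ * (x * y)     ≡⟨ cong (x ⁻¹ *_) xy≡0 ⟩
    x ⁻¹ * 0#          ≡⟨ *-zeroʳ _ ⟩
    0#                 ∎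
    where open ≡-Reasoning

  sumR-zero : (f : Fin n → Carrier) → (∀ j → f j ≡ 0#) → sumR ℝ f ≡ 0#
  sumR-zero {zero}  f f≡0 = refl
  sumR-zero {suc n} f f≡0 =
    trans (cong₂ _+_ (f≡0 F.zero) (sumR-zero (f ∘ F.suc) (f≡0 ∘ F.suc))) (+-identityˡ 0#)

  sumR-single : (f : Fin n → Carrier) (i : Fin n) →
                (∀ j → j ≢ i → f j ≡ 0#) → sumR ℝ f ≡ f i
  sumR-single {suc n} f F.zero    rest≡0 =
    trans (cong (f F.zero +_) (sumR-zero (f ∘ F.suc) (λ j → rest≡0 (F.suc j) (λ ()))))
          (+-identityʳ _)
  sumR-single {suc n} f (F.suc i) rest≡0 =
    trans (cong₂ _+_ (rest≡0 F.zero (λ ()))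
                     (sumR-single (f ∘ F.suc) i (λ j j≢i → rest≡0 (F.suc j) (j≢i ∘ FinP.suc-injective))))
          (+-identityˡ _)

  module _ (G : Graph n) {A : Matrix ℝ n} (A∈S : InS ℝ G A) where

    InS-nonadj⇒0 : ∀ {i j} → i ≢ j → adj G i j ≡ false → A i j ≡ 0#
    InS-nonadj⇒0 {i} {j} i≢j ij = ≡0-stable λ Aij≢0 →
      true≢false (trans (sym (proj₁ (proj₂ A∈S i j i≢j) Aij≢0)) ij)

    InS-adj⇒≢0 : ∀ {i j} → i ≢ j → adj G i j ≡ true → A i j ≢ 0#
    InS-adj⇒≢0 {i} {j} i≢j = proj₂ (proj₂ A∈S i j i≢j)

    product-entry-single : (B : Matrix ℝ n) (u k i : Fin n) →
      (∀ j → j ≢ i → (j ≡ u ⊎ adj G u j ≡ true) → A u j * B j k ≡ 0#) →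
      sumR ℝ (λ j → A u j * B j k) ≡ A u i * B i k
    product-entry-single B u k i supported = sumR-single _ i term≡0
      where
      term≡0 : ∀ j → j ≢ i → A u j * B j k ≡ 0#
      term≡0 j j≢i with j ≟ u
      ... | yes j≡u = supported j j≢i (inj₁ j≡u)
      ... | no  j≢u with adj G u j in uj
      ...   | true  = supported j j≢i (inj₂ uj)
      ...   | false = trans (cong (_* B j k) (InS-nonadj⇒0 (j≢u ∘ sym) uj)) (*-zeroˡ _)

  CCond⇒¬CompVanishing : ∀ {n} (G : Graph n) → CCond G → ¬ CompVanishing ℝ G
  CCond⇒¬CompVanishing {n} G (u , v , w , u≢v , _ , _ , uv , uw , N[u]∖N[w]≡1 , N[u]∖N[v]≡0)
                             (A , B , A∈S , B∈S , AB≡0)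
    with countF≡1⇒∃! _ N[u]∖N[w]≡1
  ... | x , uxw , only-x with ∧-not-true uxw
  ...   | ux , wx = InS-adj⇒≢0 G A∈S (adj⇒≢ G ux) ux (*-integral (B-nonzero x≢w xw) Bxw·Aux≡0)
    where
    B-zero : ∀ {i j : Fin n} → i ≢ j → adj G i j ≡ true → B i j ≡ 0#
    B-zero i≢j ij = InS-nonadj⇒0 (compl G) B∈S i≢j (trans (compl-adj G i≢j) (cong not ij))

    B-nonzero : ∀ {i j : Fin n} → i ≢ j → adj G i j ≡ false → B i j ≢ 0#
    B-nonzero i≢j ij = InS-adj⇒≢0 (compl G) B∈S i≢j (trans (compl-adj G i≢j) (cong not ij))

    x≢w : x ≢ w
    x≢w = adj-separates G ux uw

    xw : adj G x w ≡ false
    xw = trans (Graph.sym G x w) wx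

    Auu≡0 : A u u ≡ 0#
    Auu≡0 = *-integral (B-nonzero u≢v uv) (trans (*-comm _ _)
      (trans (sym (product-entry-single G A∈S B u v u supported)) (AB≡0 u v)))
      where
      supported : ∀ j → j ≢ u → (j ≡ u ⊎ adj G u j ≡ true) → A u j * B j v ≡ 0#
      supported j j≢u (inj₁ j≡u) = contradiction j≡u j≢u
      supported j j≢u (inj₂ uj)  = trans (cong (A u j *_) (B-zero (adj-separates G uj uv)
        (trans (Graph.sym G j v) (∧-not-false uj (countF≡0⇒false _ N[u]∖N[v]≡0 j)))))
        (*-zeroʳ _)

    Bxw·Aux≡0 : B x w * A u x ≡ 0#
    Bxw·Aux≡0 = trans (*-comm _ _)
      (trans (sym (product-entry-single G A∈S B u w x supported)) (AB≡0 u w))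
      where
      supported : ∀ j → j ≢ x → (j ≡ u ⊎ adj G u j ≡ true) → A u j * B j w ≡ 0#
      supported j j≢x (inj₁ refl) = trans (cong (_* B u w) Auu≡0) (*-zeroˡ _)
      supported j j≢x (inj₂ uj) with adj G w j in wj
      ... | true  = trans (cong (A u j *_) (B-zero (adj-separates G uj uw)
                      (trans (Graph.sym G j w) wj))) (*-zeroʳ _)
      ... | false = contradiction (only-x j (cong₂ (λ a b → a ∧ not b) uj wj)) j≢x

lemma3p7 : (ℝ : RealField) → ∀ {d h} (D : Graph d) (H : Graph h) →
    InD ℝ D → 1 ≤ h →
    InC (D ⊔ H) × ¬ CompVanishing ℝ (D ⊔ H)
lemma3p7 ℝ D H (_ , ℓ , x , deg-ℓ , ℓx , deg-x) (ℕ.s≤s ℕ.z≤n)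
  with countF≥2⇒other (adj D x) deg-x ℓ
... | y , y≢ℓ , xy = inj₁ c , CCond⇒¬CompVanishing ℝ (D ⊔ H) c
  where
  c : CCond (D ⊔ H)
  c = pendant⇒CCond (D ⊔ H)
        (trans (deg-⊔-↑ˡ D H ℓ) deg-ℓ) (trans (⊔-adj-↑ˡ D H ℓ x) ℓx)
        (trans (⊔-adj-↑ˡ D H x y) xy) (y≢ℓ ∘ ↑ˡ-injective _ y ℓ)
        (⊔-adj-↑ˡ↑ʳ D H ℓ F.zero) (⊔-adj-↑ˡ↑ʳ D H x F.zero)
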